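{- For every integer $n\ge 3$, \[ \{C_{n-2}+C_{n-3},\ C_3C_{n-3},\ C_2C_{n-2},\ C_{n-1},\ C_n\}\subseteq\mathcal{R}(n,1). \]
   Context: $C_i=\frac{1}{i+1}\binom{2i}{i}$ is the $i$-th Catalan number. Consider words over the alphabet $\{A,\overline{A}\}$, where $A$ and $\overline{A}$ are complements. A plane tree is a rooted tree embedded in the plane with root on top, children ordered left to right; its half edges are ordered by starting at the root and tracing the perimeter counterclockwise, touching each side of each edge once. For a word $w=w[1]\cdots w[2n]$ and plane tree $T$ with $n$ edges, label the $i$-th half edge by $w[i]$; $T$ is $w$-valid if the two labels of every edge are complements. $\mathcal{R}(n,1)$ is the set of integers $k\ge 0$ such that some word of length $2n$ over $\{A,\overline{A}\}$ has exactly $k$ valid plane trees. -}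

module Defs where

open import Data.Nat using (ℕ; zero; suc; _+_; _*_; _∸_)
open import Data.Nat.Combinatorics using (_C_)
open import Data.Nat.DivMod using (_/_)
open import Data.List using (List; []; _∷_; length)
open import Data.List.Membership.Propositional using (_∈_)
open import Data.List.Relation.Unary.Unique.Propositional using (Unique)
open import Data.Maybe using (Maybe; just; nothing; _>>=_)
open import Data.Vec using (Vec; toList)
open import Data.Product using (Σ; _×_; ∃)
open import Function.Bundles using (_⇔_)
open import Relation.Binary.PropositionalEquality using (_≡_)

catalan : ℕ → ℕ
catalan i = ((2 * i) C i) / suc i

data Letter : Set where
  A  : Letter
  A̅ : Letter

complement : Letter → Letter
complement A  = A̅
complement A̅ = A

data PlaneTree : Set where
  node : List PlaneTree → PlaneTree

mutual
  edges : PlaneTree → ℕ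
  edges (node ts) = edgesF ts

  edgesF : List PlaneTree → ℕ
  edgesF []       = 0
  edgesF (t ∷ ts) = suc (edges t + edgesF ts)

-- Walking the perimeter from the root (children left to right), each edge
-- is met twice: going down (first half edge) and coming back up (second
-- half edge).  'consumeF ts w' reads letters of w along the perimeter of the
-- forest ts, checking that the two labels of each edge are complements;
-- it returns the unread rest of w, or nothing if a check fails / w runs out.
mutual
  consume : PlaneTree → List Letter → Maybe (List Letter)
  consume (node ts) w = consumeF ts w

  consumeF : List PlaneTree → List Letter → Maybe (List Letter)
  consumeF []       w = just w
  consumeF (t ∷ ts) [] = nothing
  consumeF (t ∷ ts) (a ∷ w) = consume t w >>= λ
    { [] → nothing
    ; (b ∷ w′) → checkComp a b (consumeF ts w′) }

  checkComp : Letter → Letter → Maybe (List Letter) → Maybe (List Letter)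
  checkComp A  A̅ r = r
  checkComp A̅ A  r = r
  checkComp _  _  _ = nothing

Valid : (n : ℕ) → Vec Letter (2 * n) → PlaneTree → Set
Valid n w T = (edges T ≡ n) × (consume T (toList w) ≡ just [])

HasExactlyValid : (n : ℕ) → Vec Letter (2 * n) → ℕ → Set
HasExactlyValid n w k =
  Σ (List PlaneTree) λ L → Unique L × (length L ≡ k) × (∀ T → (T ∈ L) ⇔ Valid n w T)

InR : ℕ → ℕ → Set
InR n k = ∃ λ (w : Vec Letter (2 * n)) → HasExactlyValid n w k

module Submission where

-- Along the perimeter walk the two half edges of an edge sit at positions of
-- opposite parity, so a forest with e edges reads the alternating word
-- y ȳ y ȳ … of length 2e, and this is the only way a forest can read an
-- alternating word.  No edge can straddle a repeated letter, so the trees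
-- valid for A̅ A … A̅ A A A̅ … A A̅, with 2k and 2m letters on the two sides,
-- are the roots over a k-edge forest followed by an m-edge forest: C_k C_m
-- of them, which gives the last four numbers.  For A̅ A A A̅ A̅ A followed by
-- an alternating word, the first subtree of the root is either a leaf or a
-- path of three edges, which gives C_{n-2} + C_{n-3}.  Forests with e edges
-- are enumerated along the ballot recurrence, and the reflection formula for
-- ballot numbers shows that there are C_e of them.

open import Defs
open import Data.Nat
open import Data.Nat.Properties
open import Data.Nat.DivMod using (_/_; m/n*n≡m; m*n/n≡m)
open import Data.Nat.Combinatorics
open import Data.Nat.Tactic.RingSolver using (solve-∀)
import Algebra.Properties.CommutativeSemigroup as CommSemigroupProperties
open CommSemigroupProperties +-commutativeSemigroup using (interchange; x∙yz≈xz∙y)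
open CommSemigroupProperties *-commutativeSemigroup using (x∙yz≈y∙xz)
open import Data.List using (List; []; _∷_; length; map; _++_; cartesianProductWith)
open import Data.List.Properties
  using (length-map; length-++; ++-assoc; ++-identityʳ; ++-cancelˡ; ++-conicalˡ; ++-conicalʳ; ∷-injectiveˡ; ∷-injectiveʳ)
open import Data.List.Membership.Propositional using (_∈_)
open import Data.List.Membership.Propositional.Properties
  using (∈-map⁺; ∈-map⁻; ∈-++⁺ˡ; ∈-++⁺ʳ; ∈-++⁻; ∈-cartesianProductWith⁺; ∈-cartesianProductWith⁻)
open import Data.List.Relation.Unary.Any using (here)
open import Data.List.Relation.Unary.All as All using (All; lookup; tabulate)
open import Data.List.Relation.Unary.AllPairs using ([]; _∷_)
open import Data.List.Relation.Unary.Unique.Propositional using (Unique)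
open import Data.List.Relation.Unary.Unique.Propositional.Properties using (map⁺; ++⁺)
open import Data.List.Relation.Binary.Disjoint.Propositional using (Disjoint)
open import Data.Vec using (Vec; []; _∷_; replicate; head; fromList; toList; cast)
open import Data.Vec.Properties using (toList∘fromList; toList-cast)
open import Data.Maybe using (Maybe; just; nothing; _>>=_)
open import Data.Maybe.Properties using (just-injective)
open import Data.Product using (_×_; _,_; ∃; ∃₂)
open import Data.Sum using (_⊎_; inj₁; inj₂; [_,_]′)
open import Data.Empty using (⊥-elim)
open import Function using (_∘_)
open import Function.Bundles using (_⇔_; mk⇔)
open import Relation.Nullary using (¬_)
open import Relation.Binary.PropositionalEquality

-- Ballot and Catalan numbers

C-ratio : ∀ {n k} → k < n → (n C k) * (n ∸ k) ≡ (n C suc k) * suc k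
C-ratio {n} {k} k<n = *-cancelʳ-≡ ((n C k) * (n ∸ k)) ((n C suc k) * suc k) d[k+1] (begin
    (n C k) * (n ∸ k) * d[k+1]       ≡⟨ *-assoc (n C k) (n ∸ k) d[k+1] ⟩
    (n C k) * ((n ∸ k) * d[k+1])     ≡⟨ cong ((n C k) *_) ([n-k]*d[k+1]≡[k+1]*d[k] k<n) ⟩
    (n C k) * (suc k * d[k])         ≡⟨ x∙yz≈y∙xz (n C k) (suc k) d[k] ⟩
    suc k * ((n C k) * d[k])         ≡⟨ cong (suc k *_) (trans (C*denominator (<⇒≤ k<n)) (sym (C*denominator k<n))) ⟩
    suc k * ((n C suc k) * d[k+1])   ≡⟨ sym (*-assoc (suc k) (n C suc k) d[k+1]) ⟩
    suc k * (n C suc k) * d[k+1]     ≡⟨ cong (_* d[k+1]) (*-comm (suc k) (n C suc k)) ⟩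
    (n C suc k) * suc k * d[k+1]     ∎)
  where
  open ≡-Reasoning
  d[k] = k ! * (n ∸ k) !
  d[k+1] = suc k ! * (n ∸ suc k) !
  instance
    _ : NonZero d[k+1]
    _ = suc k !* (n ∸ suc k) !≢0
  C*denominator : ∀ {j} → j ≤ n → (n C j) * (j ! * (n ∸ j) !) ≡ n !
  C*denominator {j} j≤n =
    trans (cong (_* (j ! * (n ∸ j) !)) (nCk≡n!/k![n-k]! j≤n))
          (m/n*n≡m {{j !* (n ∸ j) !≢0}} (k![n∸k]!∣n! j≤n))

ballot : ℕ → ℕ → ℕ
ballot h       zero    = 1
ballot zero    (suc e) = ballot 1 e
ballot (suc h) (suc e) = ballot h (suc e) + ballot (suc (suc h)) e

ballot-reflection : ∀ h e → ballot h e + (h + 2 * e) C suc (h + e) ≡ (h + 2 * e) C e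
ballot-reflection h zero = cong (1 +_) (k>n⇒nCk≡0 (n<1+n (h + 0)))
ballot-reflection zero (suc e) = begin
    ballot 1 e + 2 * suc e C suc (suc e)
      ≡⟨ cong (λ m → ballot 1 e + m C suc (suc e)) (*-suc 2 e) ⟩
    ballot 1 e + suc N C suc (suc e)
      ≡⟨ cong (ballot 1 e +_) (sym (nCk+nC[k+1]≡[n+1]C[k+1] N (suc e))) ⟩
    ballot 1 e + (N C suc e + N C suc (suc e))
      ≡⟨ x∙yz≈xz∙y (ballot 1 e) _ _ ⟩
    ballot 1 e + N C suc (suc e) + N C suc e
      ≡⟨ cong (_+ N C suc e) (ballot-reflection 1 e) ⟩
    N C e + N C suc e
      ≡⟨ nCk+nC[k+1]≡[n+1]C[k+1] N e ⟩
    suc N C suc e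
      ≡⟨ cong (_C suc e) (sym (*-suc 2 e)) ⟩
    2 * suc e C suc e ∎
  where
  open ≡-Reasoning
  N = suc (2 * e)
ballot-reflection (suc h) (suc e) = begin
    b₁ + b₂ + suc N C suc (suc a)
      ≡⟨ cong (b₁ + b₂ +_) (sym (nCk+nC[k+1]≡[n+1]C[k+1] N (suc a))) ⟩
    b₁ + b₂ + (N C suc a + N C suc (suc a))
      ≡⟨ interchange b₁ b₂ _ _ ⟩
    (b₁ + N C suc a) + (b₂ + N C suc (suc a))
      ≡⟨ cong₂ _+_ (ballot-reflection h (suc e)) reflection₂ ⟩
    N C suc e + N C e
      ≡⟨ +-comm (N C suc e) _ ⟩
    N C e + N C suc e
      ≡⟨ nCk+nC[k+1]≡[n+1]C[k+1] N e ⟩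
    suc N C suc e ∎
  where
  open ≡-Reasoning
  b₁ = ballot h (suc e)
  b₂ = ballot (suc (suc h)) e
  N = h + 2 * suc e
  a = h + suc e
  shift : ∀ h e → suc (suc h) + 2 * e ≡ h + 2 * suc e
  shift = solve-∀
  reflection₂ : b₂ + N C suc (suc a) ≡ N C e
  reflection₂ = begin
    b₂ + N C suc (suc a)
      ≡⟨ cong₂ (λ m i → b₂ + m C i) (sym (shift h e)) (cong (suc ∘ suc) (+-suc h e)) ⟩
    b₂ + (suc (suc h) + 2 * e) C suc (suc (suc h) + e)
      ≡⟨ ballot-reflection (suc (suc h)) e ⟩
    (suc (suc h) + 2 * e) C e
      ≡⟨ cong (_C e) (shift h e) ⟩
    N C e ∎

ballot-0*[1+e]≡central : ∀ e → ballot 0 e * suc e ≡ (2 * e) C e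
ballot-0*[1+e]≡central zero    = refl
ballot-0*[1+e]≡central (suc e) = +-cancelʳ-≡ ((2 * m C suc m) * suc m) (ballot 0 m * suc m) central (begin
    ballot 0 m * suc m + (2 * m C suc m) * suc m  ≡⟨ sym (*-distribʳ-+ (suc m) (ballot 0 m) _) ⟩
    (ballot 0 m + 2 * m C suc m) * suc m          ≡⟨ cong (_* suc m) (ballot-reflection 0 m) ⟩
    central * suc m                               ≡⟨ *-suc central m ⟩
    central + central * m                         ≡⟨ cong (λ d → central + central * d) (sym 2m∸m≡m) ⟩
    central + central * (2 * m ∸ m)               ≡⟨ cong (central +_) (C-ratio m<2m) ⟩
    central + (2 * m C suc m) * suc m             ∎)
  where
  open ≡-Reasoning
  m = suc e
  central = 2 * m C m
  2m∸m≡m : 2 * m ∸ m ≡ m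
  2m∸m≡m = trans (m+n∸m≡n m (m + 0)) (+-identityʳ m)
  m<2m : m < 2 * m
  m<2m = m<m+n m z<s

catalan≡ballot : ∀ e → catalan e ≡ ballot 0 e
catalan≡ballot e = trans (cong (_/ suc e) (sym (ballot-0*[1+e]≡central e))) (m*n/n≡m (ballot 0 e) (suc e))

-- Enumerating forests

Forest : Set
Forest = List PlaneTree

-- A forest under construction from right to left with h nodes still open:
-- the top entry lists the children found so far of the innermost open node.
Stack : ℕ → Set
Stack h = Vec Forest (suc h)

stackEdges : ∀ {h} → Vec Forest h → ℕ
stackEdges []       = 0
stackEdges (f ∷ fs) = edgesF f + stackEdges fs

close : ∀ {h} → Stack (suc h) → Stack h
close (cs ∷ f ∷ fs) = (node cs ∷ f) ∷ fs

-- The top entry is either empty or begins with a tree produced by close,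
-- which makes the lengths follow the ballot recurrence.
stacks : (h e : ℕ) → List (Stack h)
stacks h       zero    = replicate (suc h) [] ∷ []
stacks zero    (suc e) = map close (stacks 1 e)
stacks (suc h) (suc e) = map ([] ∷_) (stacks h (suc e)) ++ map close (stacks (suc (suc h)) e)

length-stacks : ∀ h e → length (stacks h e) ≡ ballot h e
length-stacks h       zero    = refl
length-stacks zero    (suc e) = trans (length-map close (stacks 1 e)) (length-stacks 1 e)
length-stacks (suc h) (suc e) = begin
    length (map ([] ∷_) (stacks h (suc e)) ++ map close (stacks (suc (suc h)) e))
      ≡⟨ length-++ (map ([] ∷_) (stacks h (suc e))) ⟩
    length (map ([] ∷_) (stacks h (suc e))) + length (map close (stacks (suc (suc h)) e))
      ≡⟨ cong₂ _+_ (length-map ([] ∷_) (stacks h (suc e))) (length-map close (stacks (suc (suc h)) e)) ⟩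
    length (stacks h (suc e)) + length (stacks (suc (suc h)) e)
      ≡⟨ cong₂ _+_ (length-stacks h (suc e)) (length-stacks (suc (suc h)) e) ⟩
    ballot (suc h) (suc e) ∎
  where open ≡-Reasoning

stackEdges-close : ∀ {h} (fs : Stack (suc h)) → stackEdges (close fs) ≡ suc (stackEdges fs)
stackEdges-close (cs ∷ f ∷ fs) = cong suc (+-assoc (edgesF cs) (edgesF f) (stackEdges fs))

stackEdges≡0⇒empty : ∀ {h} (fs : Vec Forest h) → stackEdges fs ≡ 0 → fs ≡ replicate h []
stackEdges≡0⇒empty []        _  = refl
stackEdges≡0⇒empty ([] ∷ fs) eq = cong ([] ∷_) (stackEdges≡0⇒empty fs eq)

stackEdges-replicate : ∀ h → stackEdges (replicate h []) ≡ 0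
stackEdges-replicate zero    = refl
stackEdges-replicate (suc h) = stackEdges-replicate h

∈-stacks⁻ : ∀ h e {fs : Stack h} → fs ∈ stacks h e → stackEdges fs ≡ e
∈-close-stacks⁻ : ∀ h e {fs : Stack h} → fs ∈ map close (stacks (suc h) e) → stackEdges fs ≡ suc e

∈-stacks⁻ h zero (here refl) = stackEdges-replicate (suc h)
∈-stacks⁻ zero (suc e) fs∈ = ∈-close-stacks⁻ 0 e fs∈
∈-stacks⁻ (suc h) (suc e) fs∈ =
  [ (λ pushed → let gs , gs∈ , fs≡ = ∈-map⁻ ([] ∷_) pushed in
                 trans (cong stackEdges fs≡) (∈-stacks⁻ h (suc e) gs∈))
  , ∈-close-stacks⁻ (suc h) e
  ]′ (∈-++⁻ (map ([] ∷_) (stacks h (suc e))) fs∈)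

∈-close-stacks⁻ h e fs∈ = let gs , gs∈ , fs≡ = ∈-map⁻ close fs∈ in
  trans (cong stackEdges fs≡) (trans (stackEdges-close gs) (cong suc (∈-stacks⁻ (suc h) e gs∈)))

∈-stacks⁺ : ∀ h e (fs : Stack h) → stackEdges fs ≡ e → fs ∈ stacks h e
∈-stacks⁺ h zero fs eq rewrite stackEdges≡0⇒empty fs eq = here refl
∈-stacks⁺ zero (suc e) ((node cs ∷ f) ∷ []) eq =
  ∈-map⁺ close (∈-stacks⁺ 1 e (cs ∷ f ∷ []) (suc-injective (trans (sym (stackEdges-close (cs ∷ f ∷ []))) eq)))
∈-stacks⁺ (suc h) (suc e) ([] ∷ fs) eq =
  ∈-++⁺ˡ (∈-map⁺ ([] ∷_) (∈-stacks⁺ h (suc e) fs eq))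
∈-stacks⁺ (suc h) (suc e) ((node cs ∷ f) ∷ fs) eq =
  ∈-++⁺ʳ (map ([] ∷_) (stacks h (suc e)))
    (∈-map⁺ close (∈-stacks⁺ (suc (suc h)) e (cs ∷ f ∷ fs)
      (suc-injective (trans (sym (stackEdges-close (cs ∷ f ∷ fs))) eq))))

close-injective : ∀ {h} {fs gs : Stack (suc h)} → close fs ≡ close gs → fs ≡ gs
close-injective {fs = _ ∷ _ ∷ _} {_ ∷ _ ∷ _} refl = refl

stacks-unique : ∀ h e → Unique (stacks h e)
stacks-unique h       zero    = All.[] ∷ []
stacks-unique zero    (suc e) = map⁺ close-injective (stacks-unique 1 e)
stacks-unique (suc h) (suc e) =
  ++⁺ (map⁺ push-injective (stacks-unique h (suc e))) (map⁺ close-injective (stacks-unique (suc (suc h)) e)) disjoint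
  where
  push-injective : ∀ {fs gs : Stack h} → _≡_ {A = Stack (suc h)} ([] ∷ fs) ([] ∷ gs) → fs ≡ gs
  push-injective refl = refl
  disjoint : Disjoint (map ([] ∷_) (stacks h (suc e))) (map close (stacks (suc (suc h)) e))
  disjoint (popped , closed) with ∈-map⁻ ([] ∷_) popped | ∈-map⁻ close closed
  ... | _ , _ , refl | (_ ∷ _ ∷ _) , _ , ()

forests : ℕ → List Forest
forests e = map head (stacks 0 e)

length-forests : ∀ e → length (forests e) ≡ catalan e
length-forests e = trans (length-map head (stacks 0 e)) (trans (length-stacks 0 e) (sym (catalan≡ballot e)))

forests-unique : ∀ e → Unique (forests e)
forests-unique e = map⁺ head-injective (stacks-unique 0 e)
  where
  head-injective : ∀ {fs gs : Stack 0} → head fs ≡ head gs → fs ≡ gs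
  head-injective {_ ∷ []} {_ ∷ []} refl = refl

∈-forests⁻ : ∀ e {f} → f ∈ forests e → edgesF f ≡ e
∈-forests⁻ e f∈ with ∈-map⁻ head f∈
... | (f ∷ []) , fs∈ , refl = trans (sym (+-identityʳ (edgesF f))) (∈-stacks⁻ 0 e fs∈)

∈-forests⁺ : ∀ {e f} → edgesF f ≡ e → f ∈ forests e
∈-forests⁺ {e} {f} eq = ∈-map⁺ head (∈-stacks⁺ 0 e (f ∷ []) (trans (+-identityʳ (edgesF f)) eq))

-- Reading alternating words

complement-involutive : ∀ y → complement (complement y) ≡ y
complement-involutive A  = refl
complement-involutive A̅ = refl

complement-≢ : ∀ y → ¬ y ≡ complement y
complement-≢ A  ()
complement-≢ A̅ ()

alt : Letter → ℕ → List Letter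
alt y zero    = []
alt y (suc l) = y ∷ alt (complement y) l

altNext : Letter → ℕ → Letter
altNext y zero    = y
altNext y (suc l) = altNext (complement y) l

length-alt : ∀ y l → length (alt y l) ≡ l
length-alt y zero    = refl
length-alt y (suc l) = cong suc (length-alt (complement y) l)

alt-+ : ∀ y a b → alt y (a + b) ≡ alt y a ++ alt (altNext y a) b
alt-+ y zero    b = refl
alt-+ y (suc a) b = cong (y ∷_) (alt-+ (complement y) a b)

altNext-2*+ : ∀ y c j → altNext y (2 * c + j) ≡ altNext y j
altNext-2*+ y zero    j = refl
altNext-2*+ y (suc c) j = begin
    altNext y (2 * suc c + j)                              ≡⟨ cong (altNext y) (cong (_+ j) (*-suc 2 c)) ⟩
    altNext (complement (complement y)) (2 * c + j)        ≡⟨ cong (λ x → altNext x (2 * c + j)) (complement-involutive y) ⟩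
    altNext y (2 * c + j)                                  ≡⟨ altNext-2*+ y c j ⟩
    altNext y j                                            ∎
  where open ≡-Reasoning

altNext-2* : ∀ y c → altNext y (2 * c) ≡ y
altNext-2* y c = trans (cong (altNext y) (sym (+-identityʳ (2 * c)))) (altNext-2*+ y c 0)

1+2c+[1+2d]≡2[1+c+d] : ∀ c d → suc (2 * c + suc (2 * d)) ≡ 2 * suc (c + d)
1+2c+[1+2d]≡2[1+c+d] = solve-∀

1+2c+[1+2d+k]≡2[1+c+d]+k : ∀ c d k → suc (2 * c + suc (2 * d + k)) ≡ 2 * suc (c + d) + k
1+2c+[1+2d+k]≡2[1+c+d]+k = solve-∀

edgesF-++ : ∀ p f → edgesF (p ++ f) ≡ edgesF p + edgesF f
edgesF-++ []      f = refl
edgesF-++ (t ∷ p) f = cong suc (trans (cong (edges t +_) (edgesF-++ p f)) (sym (+-assoc (edges t) _ _)))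

>>=-just⁻ : ∀ {A B : Set} (m : Maybe A) (f : A → Maybe B) {r} →
  (m >>= f) ≡ just r → ∃ λ x → m ≡ just x × f x ≡ just r
>>=-just⁻ (just x) f eq = x , refl , eq

checkComp-just⁻ : ∀ a b {r x} → checkComp a b r ≡ just x → b ≡ complement a × r ≡ just x
checkComp-just⁻ A  A  ()
checkComp-just⁻ A  A̅ eq = refl , eq
checkComp-just⁻ A̅ A  eq = refl , eq
checkComp-just⁻ A̅ A̅ ()

checkComp-complement : ∀ a {r} → checkComp a (complement a) r ≡ r
checkComp-complement A  = refl
checkComp-complement A̅ = refl

consumeF-∷⁻ : ∀ t ts a w {r} → consumeF (t ∷ ts) (a ∷ w) ≡ just r →
  ∃ λ w′ → consume t w ≡ just (complement a ∷ w′) × consumeF ts w′ ≡ just r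
consumeF-∷⁻ t ts a w eq with >>=-just⁻ (consume t w) _ eq
... | []      , _   , ()
... | b ∷ w′ , t↓ , ts↓ with checkComp-just⁻ a b ts↓
...   | refl , ts↓′ = w′ , t↓ , ts↓′

consumeF-∷⁺ : ∀ t ts a w w′ → consume t w ≡ just (complement a ∷ w′) →
  consumeF (t ∷ ts) (a ∷ w) ≡ consumeF ts w′
consumeF-∷⁺ t ts a w w′ t↓ rewrite t↓ = checkComp-complement a

consumeF-++ : ∀ p f w → consumeF (p ++ f) w ≡ (consumeF p w >>= consumeF f)
consumeF-++ []      f w       = refl
consumeF-++ (t ∷ p) f []      = refl
consumeF-++ (t ∷ p) f (a ∷ w) with consume t w
... | nothing      = refl
... | just []      = refl
... | just (b ∷ w′) with a | b
...   | A  | A  = refl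
...   | A  | A̅ = consumeF-++ p f w′
...   | A̅ | A  = consumeF-++ p f w′
...   | A̅ | A̅ = refl

alt-∷⁻ : ∀ {y l a w} → a ∷ w ≡ alt y l → ∃ λ l′ → l ≡ suc l′ × a ≡ y × w ≡ alt (complement y) l′
alt-∷⁻ {l = suc l} refl = l , refl , refl , refl

alt-2*[1+c+d] : ∀ y c d → alt y (2 * suc (c + d)) ≡ y ∷ (alt (complement y) (2 * c) ++ complement y ∷ alt y (2 * d))
alt-2*[1+c+d] y c d = begin
    alt y (2 * suc (c + d))
      ≡⟨ cong (alt y) (sym (1+2c+[1+2d]≡2[1+c+d] c d)) ⟩
    y ∷ alt (complement y) (2 * c + suc (2 * d))
      ≡⟨ cong (y ∷_) (alt-+ (complement y) (2 * c) (suc (2 * d))) ⟩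
    y ∷ (alt (complement y) (2 * c) ++ alt (altNext (complement y) (2 * c)) (suc (2 * d)))
      ≡⟨ cong (λ x → y ∷ (alt (complement y) (2 * c) ++ alt x (suc (2 * d)))) (altNext-2* (complement y) c) ⟩
    y ∷ (alt (complement y) (2 * c) ++ complement y ∷ alt (complement (complement y)) (2 * d))
      ≡⟨ cong (λ x → y ∷ (alt (complement y) (2 * c) ++ complement y ∷ alt x (2 * d))) (complement-involutive y) ⟩
    y ∷ (alt (complement y) (2 * c) ++ complement y ∷ alt y (2 * d)) ∎
  where open ≡-Reasoning

consumeF-alt : ∀ ts y s → consumeF ts (alt y (2 * edgesF ts) ++ s) ≡ just s
consumeF-alt []             y s = refl
consumeF-alt (node cs ∷ ts) y s = begin
    consumeF (node cs ∷ ts) (alt y (2 * suc (c + d)) ++ s)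
      ≡⟨ cong (λ w → consumeF (node cs ∷ ts) (w ++ s)) (alt-2*[1+c+d] y c d) ⟩
    consumeF (node cs ∷ ts) (y ∷ (alt (complement y) (2 * c) ++ complement y ∷ alt y (2 * d)) ++ s)
      ≡⟨ cong (λ w → consumeF (node cs ∷ ts) (y ∷ w)) (++-assoc (alt (complement y) (2 * c)) _ s) ⟩
    consumeF (node cs ∷ ts) (y ∷ alt (complement y) (2 * c) ++ complement y ∷ alt y (2 * d) ++ s)
      ≡⟨ consumeF-∷⁺ (node cs) ts y _ _ (consumeF-alt cs (complement y) _) ⟩
    consumeF ts (alt y (2 * d) ++ s)
      ≡⟨ consumeF-alt ts y s ⟩
    just s ∎
  where
  open ≡-Reasoning
  c = edgesF cs
  d = edgesF ts

consumeF-alt⁻ : ∀ ts y l {r} → consumeF ts (alt y l) ≡ just r → ∃ λ j → l ≡ 2 * edgesF ts + j × r ≡ alt y j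
consumeF-alt⁻ []             y l       ts↓ = l , refl , sym (just-injective ts↓)
consumeF-alt⁻ (t ∷ ts)       y zero    ()
consumeF-alt⁻ (node cs ∷ ts) y (suc l) ts↓ with consumeF-∷⁻ (node cs) ts y (alt (complement y) l) ts↓
... | w′ , cs↓ , ts↓′ with consumeF-alt⁻ cs (complement y) l cs↓
...   | j , refl , rest≡ with alt-∷⁻ rest≡
...     | j′ , refl , _ , w′≡ rewrite complement-involutive y
  with consumeF-alt⁻ ts y j′ (subst (λ w → consumeF ts w ≡ just _) w′≡ ts↓′)
...       | k , refl , r≡ = k , 1+2c+[1+2d+k]≡2[1+c+d]+k (edgesF cs) (edgesF ts) k , r≡

consumeF-alt-exact : ∀ ts y → consumeF ts (alt y (2 * edgesF ts)) ≡ just []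
consumeF-alt-exact ts y = subst (λ w → consumeF ts w ≡ just []) (++-identityʳ _) (consumeF-alt ts y [])

alt-∷-≢ : ∀ y z m {w} → z ≡ y → ¬ complement y ∷ w ≡ alt z m
alt-∷-≢ y z m refl w≡ with alt-∷⁻ w≡
... | _ , _ , ȳ≡y , _ = complement-≢ y (sym ȳ≡y)

consumeF-repeat⁻ : ∀ ts y l {r} → consumeF ts (y ∷ alt y l) ≡ just r → ts ≡ []
consumeF-repeat⁻ []             y l ts↓ = refl
consumeF-repeat⁻ (node cs ∷ ts) y l ts↓ with consumeF-∷⁻ (node cs) ts y (alt y l) ts↓
... | w′ , cs↓ , _ with consumeF-alt⁻ cs y l cs↓
...   | _ , _ , w≡ = ⊥-elim (alt-∷-≢ y y _ refl w≡)

-- Words with one repeated letter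

data JunctionRead (ts : Forest) (y : Letter) (l : ℕ) (z : Letter) (m : ℕ) (r : List Letter) : Set where
  stopsBefore : ∀ j → l ≡ 2 * edgesF ts + j → r ≡ alt y j ++ alt z m → JunctionRead ts y l z m r
  splitsAt    : ∀ p f → ts ≡ p ++ f → l ≡ 2 * edgesF p → consumeF f (alt z m) ≡ just r →
                JunctionRead ts y l z m r

-- z ≡ complement (altNext y l) says that the letter before the junction is
-- repeated after it; no edge can have its two sides on different sides of it.
consumeF-junction⁻ : ∀ ts y l z m {r} → z ≡ complement (altNext y l) →
  consumeF ts (alt y l ++ alt z m) ≡ just r → JunctionRead ts y l z m r
consumeF-junction⁻ []             y l       z m z≡ ts↓ = stopsBefore l refl (sym (just-injective ts↓))
consumeF-junction⁻ (t ∷ ts)       y zero    z m z≡ ts↓ = splitsAt [] (t ∷ ts) refl refl ts↓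
consumeF-junction⁻ (node cs ∷ ts) y (suc l) z m z≡ ts↓
  with consumeF-∷⁻ (node cs) ts y (alt (complement y) l ++ alt z m) ts↓
... | w′ , cs↓ , ts↓′ with consumeF-junction⁻ cs (complement y) l z m z≡ cs↓
...   | splitsAt p f refl refl f↓ with consumeF-alt⁻ f z m f↓
...     | _ , _ , w≡ =
  ⊥-elim (alt-∷-≢ y z _ (trans z≡ (trans (cong complement (altNext-2* (complement y) (edgesF p))) (complement-involutive y))) w≡)
consumeF-junction⁻ (node cs ∷ ts) y (suc l) z m z≡ ts↓
    | w′ , cs↓ , ts↓′ | stopsBefore zero refl w≡ =
  ⊥-elim (alt-∷-≢ y z m (trans z≡ (trans (cong complement (altNext-2*+ (complement y) (edgesF cs) 0)) (complement-involutive y))) w≡)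
consumeF-junction⁻ (node cs ∷ ts) y (suc l) z m z≡ ts↓
    | w′ , cs↓ , ts↓′ | stopsBefore (suc j) refl w≡
  with consumeF-junction⁻ ts y j z m z≡′ (subst (λ w → consumeF ts w ≡ just _) w′≡ ts↓′)
  where
  w′≡ : w′ ≡ alt y j ++ alt z m
  w′≡ = trans (∷-injectiveʳ w≡) (cong (λ x → alt x j ++ alt z m) (complement-involutive y))
  z≡′ : z ≡ complement (altNext y j)
  z≡′ = trans z≡ (cong complement (trans (altNext-2*+ (complement y) (edgesF cs) (suc j))
                                         (cong (λ x → altNext x j) (complement-involutive y))))
... | stopsBefore k refl r≡ = stopsBefore k (1+2c+[1+2d+k]≡2[1+c+d]+k (edgesF cs) (edgesF ts) k) r≡
... | splitsAt p f refl refl f↓ = splitsAt (node cs ∷ p) f refl (1+2c+[1+2d]≡2[1+c+d] (edgesF cs) (edgesF p)) f↓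

InR-fromList : ∀ n (w : List Letter) → length w ≡ 2 * n → (L : List PlaneTree) → Unique L →
  (∀ T → T ∈ L ⇔ (edges T ≡ n × consume T w ≡ just [])) → InR n (length L)
InR-fromList n w |w| L L-unique L-valid =
  cast |w| (fromList w) , L , L-unique , refl ,
  λ T → subst (λ w′ → T ∈ L ⇔ (edges T ≡ n × consume T w′ ≡ just [])) (sym toList-w) (L-valid T)
  where
  toList-w : toList (cast |w| (fromList w)) ≡ w
  toList-w = trans (toList-cast |w| (fromList w)) (toList∘fromList w)

length-cartesianProductWith : ∀ {A B C : Set} (f : A → B → C) xs ys →
  length (cartesianProductWith f xs ys) ≡ length xs * length ys
length-cartesianProductWith f []       ys = refl
length-cartesianProductWith f (x ∷ xs) ys = begin
    length (map (f x) ys ++ cartesianProductWith f xs ys)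
      ≡⟨ length-++ (map (f x) ys) ⟩
    length (map (f x) ys) + length (cartesianProductWith f xs ys)
      ≡⟨ cong₂ _+_ (length-map (f x) ys) (length-cartesianProductWith f xs ys) ⟩
    length ys + length xs * length ys ∎
  where open ≡-Reasoning

node-injective : ∀ {ts us} → node ts ≡ node us → ts ≡ us
node-injective refl = refl

++-cancel-edgesF : ∀ p p′ {f f′} → edgesF p ≡ edgesF p′ → p ++ f ≡ p′ ++ f′ → p ≡ p′
++-cancel-edgesF []      []        _  _  = refl
++-cancel-edgesF []      (_ ∷ _)   () _
++-cancel-edgesF (_ ∷ _) []        () _
++-cancel-edgesF (t ∷ p) (t′ ∷ p′) e  eq with ∷-injectiveˡ eq
... | refl = cong (t ∷_) (++-cancel-edgesF p p′ (+-cancelˡ-≡ (edges t) _ _ (suc-injective e)) (∷-injectiveʳ eq))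

graft : Forest → Forest → PlaneTree
graft p f = node (p ++ f)

grafts : List Forest → List Forest → List PlaneTree
grafts = cartesianProductWith graft

grafts-unique : ∀ {k} ps fs → All (λ p → edgesF p ≡ k) ps → Unique ps → Unique fs → Unique (grafts ps fs)
grafts-unique []       fs _           _              _         = []
grafts-unique (p ∷ ps) fs (|p| All.∷ |ps|) (p∉ps ∷ ps-unique) fs-unique =
  ++⁺ (map⁺ (λ eq → ++-cancelˡ p _ _ (node-injective eq)) fs-unique)
      (grafts-unique ps fs |ps| ps-unique fs-unique)
      disjoint
  where
  disjoint : Disjoint (map (graft p) fs) (grafts ps fs)
  disjoint (T∈p , T∈ps) with ∈-map⁻ (graft p) T∈p | ∈-cartesianProductWith⁻ graft ps fs T∈ps
  ... | _ , _ , refl | p′ , _ , p′∈ps , _ , eq =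
    lookup p∉ps p′∈ps (++-cancel-edgesF p p′ (trans |p| (sym (lookup |ps| p′∈ps))) (node-injective eq))

alt≡[]⇒≡0 : ∀ y l → alt y l ≡ [] → l ≡ 0
alt≡[]⇒≡0 y zero    _ = refl
alt≡[]⇒≡0 y (suc l) ()

2*-cancel-+0 : ∀ {a b j} → 2 * a ≡ 2 * b + j → j ≡ 0 → a ≡ b
2*-cancel-+0 {a} {b} eq refl = *-cancelˡ-≡ a b 2 (trans eq (+-identityʳ (2 * b)))

junctionWord : Letter → ℕ → ℕ → List Letter
junctionWord y k m = alt y (2 * k) ++ alt (complement y) (2 * m)

consumeF-junctionWord : ∀ y p f → consumeF (p ++ f) (junctionWord y (edgesF p) (edgesF f)) ≡ just []
consumeF-junctionWord y p f = begin
    consumeF (p ++ f) (alt y (2 * edgesF p) ++ alt (complement y) (2 * edgesF f))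
      ≡⟨ consumeF-++ p f _ ⟩
    (consumeF p (alt y (2 * edgesF p) ++ alt (complement y) (2 * edgesF f)) >>= consumeF f)
      ≡⟨ cong (_>>= consumeF f) (consumeF-alt p y _) ⟩
    consumeF f (alt (complement y) (2 * edgesF f))
      ≡⟨ cong (consumeF f) (sym (++-identityʳ _)) ⟩
    consumeF f (alt (complement y) (2 * edgesF f) ++ [])
      ≡⟨ consumeF-alt f (complement y) [] ⟩
    just [] ∎
  where open ≡-Reasoning

consumeF-junctionWord⁻ : ∀ y k m ts → consumeF ts (junctionWord y k m) ≡ just [] →
  ∃₂ λ p f → ts ≡ p ++ f × edgesF p ≡ k × edgesF f ≡ m
consumeF-junctionWord⁻ y k m ts ts↓
  with consumeF-junction⁻ ts y (2 * k) (complement y) (2 * m) (cong complement (sym (altNext-2* y k))) ts↓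
... | stopsBefore j 2k≡ []≡ =
  ts , [] , sym (++-identityʳ ts) ,
  sym (2*-cancel-+0 2k≡ (alt≡[]⇒≡0 y j (++-conicalˡ (alt y j) _ (sym []≡)))) ,
  sym (*-cancelˡ-≡ m 0 2 (alt≡[]⇒≡0 (complement y) (2 * m) (++-conicalʳ (alt y j) _ (sym []≡))))
... | splitsAt p f ts≡ 2k≡ f↓ with consumeF-alt⁻ f (complement y) (2 * m) f↓
...   | j , 2m≡ , []≡ =
  p , f , ts≡ , sym (*-cancelˡ-≡ k (edgesF p) 2 2k≡) , sym (2*-cancel-+0 2m≡ (alt≡[]⇒≡0 _ j (sym []≡)))

InR-catalan-* : ∀ k m → InR (k + m) (catalan k * catalan m)
InR-catalan-* k m =
  subst (InR (k + m)) |L| (InR-fromList (k + m) (junctionWord A̅ k m) |w| L L-unique L-valid)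
  where
  L = grafts (forests k) (forests m)
  |L| : length L ≡ catalan k * catalan m
  |L| = trans (length-cartesianProductWith graft (forests k) (forests m))
              (cong₂ _*_ (length-forests k) (length-forests m))
  L-unique : Unique L
  L-unique = grafts-unique (forests k) (forests m) (tabulate (∈-forests⁻ k)) (forests-unique k) (forests-unique m)
  |w| : length (junctionWord A̅ k m) ≡ 2 * (k + m)
  |w| = trans (length-++ (alt A̅ (2 * k)))
              (trans (cong₂ _+_ (length-alt A̅ (2 * k)) (length-alt A (2 * m))) (sym (*-distribˡ-+ 2 k m)))
  L-valid : ∀ T → T ∈ L ⇔ (edges T ≡ k + m × consume T (junctionWord A̅ k m) ≡ just [])
  L-valid (node ts) = mk⇔ to from
    where
    to : node ts ∈ L → edges (node ts) ≡ k + m × consume (node ts) (junctionWord A̅ k m) ≡ just []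
    to T∈L with ∈-cartesianProductWith⁻ graft (forests k) (forests m) T∈L
    ... | p , f , p∈ , f∈ , refl with ∈-forests⁻ k p∈ | ∈-forests⁻ m f∈
    ...   | refl | refl = edgesF-++ p f , consumeF-junctionWord A̅ p f
    from : edges (node ts) ≡ k + m × consume (node ts) (junctionWord A̅ k m) ≡ just [] → node ts ∈ L
    from (_ , ts↓) with consumeF-junctionWord⁻ A̅ k m ts ts↓
    ... | p , f , refl , |p| , |f| = ∈-cartesianProductWith⁺ graft (∈-forests⁺ |p|) (∈-forests⁺ |f|)

-- The word A̅ A A A̅ A̅ A A A̅ A A̅ …

-- Inserts a leaf right after the second half edge of the perimeter walk, so
-- that the labels A A̅ A̅ A … of the result restrict to A A̅ … on the original.
insertLeaf : Forest → Forest
insertLeaf []                             = []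
insertLeaf (node []             ∷ ts) = node [] ∷ node [] ∷ ts
insertLeaf (node (node cs ∷ us) ∷ ts) = node (node (node [] ∷ cs) ∷ us) ∷ ts

consumeF-insertLeaf : ∀ t ts w →
  consumeF (insertLeaf (t ∷ ts)) (A ∷ A̅ ∷ A̅ ∷ A ∷ w) ≡ consumeF (t ∷ ts) (A ∷ A̅ ∷ w)
consumeF-insertLeaf (node [])             ts w = refl
consumeF-insertLeaf (node (node cs ∷ us)) ts w = refl

edgesF-insertLeaf : ∀ t ts → edgesF (insertLeaf (t ∷ ts)) ≡ suc (edgesF (t ∷ ts))
edgesF-insertLeaf (node [])             ts = refl
edgesF-insertLeaf (node (node cs ∷ us)) ts = refl

insertLeaf-injective : ∀ {ts us} → insertLeaf ts ≡ insertLeaf us → ts ≡ us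
insertLeaf-injective {[]}                       {[]}                        _    = refl
insertLeaf-injective {[]}                       {node [] ∷ _}               ()
insertLeaf-injective {[]}                       {node (node _ ∷ _) ∷ _}     ()
insertLeaf-injective {node [] ∷ _}              {[]}                        ()
insertLeaf-injective {node [] ∷ _}              {node [] ∷ _}               refl = refl
insertLeaf-injective {node [] ∷ _}              {node (node _ ∷ _) ∷ _}     ()
insertLeaf-injective {node (node _ ∷ _) ∷ _}    {[]}                        ()
insertLeaf-injective {node (node _ ∷ _) ∷ _}    {node [] ∷ _}               ()
insertLeaf-injective {node (node _ ∷ _) ∷ _}    {node (node _ ∷ _) ∷ _}     refl = refl

consumeF-A̅A⁻ : ∀ ts M {r} → consumeF ts (A̅ ∷ A ∷ alt A M) ≡ just r →
  (ts ≡ [] × r ≡ A̅ ∷ A ∷ alt A M) ⊎ (∃₂ λ ts′ j → ts ≡ node [] ∷ ts′ × r ≡ alt A j)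
consumeF-A̅A⁻ []             M ts↓ = inj₁ (refl , sym (just-injective ts↓))
consumeF-A̅A⁻ (node cs ∷ ts) M ts↓ with consumeF-∷⁻ (node cs) ts A̅ (A ∷ alt A M) ts↓
... | w′ , cs↓ , ts↓′ with consumeF-repeat⁻ cs A M cs↓
...   | refl with ∷-injectiveʳ (just-injective cs↓)
...     | refl with consumeF-alt⁻ ts A M ts↓′
...       | j , _ , r≡ = inj₂ (ts , j , refl , r≡)

consumeF-AA̅A̅A⁻ : ∀ ts M {r} → consumeF ts (A ∷ A̅ ∷ A̅ ∷ A ∷ alt A M) ≡ just r →
  (ts ≡ [] × r ≡ A ∷ A̅ ∷ A̅ ∷ A ∷ alt A M)
  ⊎ (ts ≡ node [] ∷ [] × r ≡ A̅ ∷ A ∷ alt A M)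
  ⊎ (∃₂ λ t f → ∃ λ j → ts ≡ insertLeaf (t ∷ f) × r ≡ alt A j)
consumeF-AA̅A̅A⁻ [] M ts↓ = inj₁ (refl , sym (just-injective ts↓))
consumeF-AA̅A̅A⁻ (node [] ∷ ts) M ts↓ with consumeF-A̅A⁻ ts M ts↓
... | inj₁ (refl , r≡)             = inj₂ (inj₁ (refl , r≡))
... | inj₂ (ts′ , j , refl , r≡) = inj₂ (inj₂ (node [] , ts′ , j , refl , r≡))
consumeF-AA̅A̅A⁻ (node (node cs ∷ us) ∷ ts) M ts↓
  with consumeF-∷⁻ (node (node cs ∷ us)) ts A (A̅ ∷ A̅ ∷ A ∷ alt A M) ts↓
... | w′ , us↓ , ts↓′ with consumeF-∷⁻ (node cs) us A̅ (A̅ ∷ A ∷ alt A M) us↓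
...   | w″ , cs↓ , us↓′ with consumeF-A̅A⁻ cs M cs↓
...     | inj₁ (_ , ())
...     | inj₂ (cs′ , j , refl , A∷w″≡) with alt-∷⁻ A∷w″≡
...       | j′ , refl , _ , w″≡ with consumeF-alt⁻ us A̅ j′ (subst (λ w → consumeF us w ≡ just _) w″≡ us↓′)
...         | k , _ , A̅∷w′≡ with alt-∷⁻ A̅∷w′≡
...           | k′ , refl , _ , w′≡ with consumeF-alt⁻ ts A k′ (subst (λ w → consumeF ts w ≡ just _) w′≡ ts↓′)
...             | i , _ , r≡ = inj₂ (inj₂ (node (node cs′ ∷ us) , ts , i , refl , r≡))

path : ℕ → PlaneTree
path zero    = node []
path (suc k) = node (path k ∷ [])

consumeF-A̅AAA̅A̅A⁻ : ∀ ts M → consumeF ts (A̅ ∷ A ∷ A ∷ A̅ ∷ A̅ ∷ A ∷ alt A M) ≡ just [] →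
  (∃₂ λ t f → ts ≡ node [] ∷ insertLeaf (t ∷ f)) ⊎ (∃ λ g → ts ≡ path 2 ∷ g)
consumeF-A̅AAA̅A̅A⁻ [] M ()
consumeF-A̅AAA̅A̅A⁻ (node [] ∷ ts) M ts↓ with consumeF-AA̅A̅A⁻ ts M ts↓
... | inj₁ (_ , ())
... | inj₂ (inj₁ (_ , ()))
... | inj₂ (inj₂ (t , f , _ , refl , _)) = inj₁ (t , f , refl)
consumeF-A̅AAA̅A̅A⁻ (node (node cs ∷ us) ∷ ts) M ts↓
  with consumeF-∷⁻ (node (node cs ∷ us)) ts A̅ (A ∷ A ∷ A̅ ∷ A̅ ∷ A ∷ alt A M) ts↓
... | w′ , us↓ , _ with consumeF-∷⁻ (node cs) us A (A ∷ A̅ ∷ A̅ ∷ A ∷ alt A M) us↓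
...   | w″ , cs↓ , us↓′ with consumeF-AA̅A̅A⁻ cs M cs↓
...     | inj₁ (_ , ())
...     | inj₂ (inj₂ (_ , _ , j , _ , A̅∷w″≡)) = ⊥-elim (alt-∷-≢ A A j refl A̅∷w″≡)
...     | inj₂ (inj₁ (refl , refl)) with consumeF-repeat⁻ us A M us↓′
...       | refl = inj₂ (ts , refl)

InR-catalan-+ : ∀ m → InR (3 + m) (catalan (suc m) + catalan m)
InR-catalan-+ m = subst (InR (3 + m)) |L| (InR-fromList (3 + m) w |w| L L-unique L-valid)
  where
  w = A̅ ∷ A ∷ A ∷ A̅ ∷ A̅ ∷ A ∷ alt A (2 * m)
  leafFirst pathFirst : Forest → PlaneTree
  leafFirst f = node (node [] ∷ insertLeaf f)
  pathFirst g = node (path 2 ∷ g)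
  L = map leafFirst (forests (suc m)) ++ map pathFirst (forests m)
  |L| : length L ≡ catalan (suc m) + catalan m
  |L| = trans (length-++ (map leafFirst (forests (suc m))))
    (cong₂ _+_ (trans (length-map leafFirst (forests (suc m))) (length-forests (suc m)))
               (trans (length-map pathFirst (forests m)) (length-forests m)))
  |w| : length w ≡ 2 * (3 + m)
  |w| = trans (cong (6 +_) (length-alt A (2 * m))) (sym (*-distribˡ-+ 2 3 m))
  L-unique : Unique L
  L-unique = ++⁺ (map⁺ (λ eq → insertLeaf-injective (∷-injectiveʳ (node-injective eq))) (forests-unique (suc m)))
                 (map⁺ (λ eq → ∷-injectiveʳ (node-injective eq)) (forests-unique m))
                 disjoint
    where
    disjoint : Disjoint (map leafFirst (forests (suc m))) (map pathFirst (forests m))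
    disjoint (T∈₁ , T∈₂) with ∈-map⁻ leafFirst T∈₁ | ∈-map⁻ pathFirst T∈₂
    ... | _ , _ , refl | _ , _ , ()
  L-valid : ∀ T → T ∈ L ⇔ (edges T ≡ 3 + m × consume T w ≡ just [])
  L-valid (node ts) = mk⇔ to from
    where
    to : node ts ∈ L → edges (node ts) ≡ 3 + m × consume (node ts) w ≡ just []
    to T∈L with ∈-++⁻ (map leafFirst (forests (suc m))) T∈L
    ... | inj₂ T∈₂ with ∈-map⁻ pathFirst T∈₂
    ...   | g , g∈ , refl with ∈-forests⁻ m g∈
    ...     | refl = refl , consumeF-alt-exact g A
    to T∈L | inj₁ T∈₁ with ∈-map⁻ leafFirst T∈₁
    ...   | [] , f∈ , refl with ∈-forests⁻ (suc m) f∈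
    ...     | ()
    to T∈L | inj₁ T∈₁ | t ∷ f , f∈ , refl with ∈-forests⁻ (suc m) f∈
    ...     | refl = cong suc (edgesF-insertLeaf t f) ,
                     trans (consumeF-insertLeaf t f (alt A (2 * (edges t + edgesF f))))
                       (subst (λ l → consumeF (t ∷ f) (alt A l) ≡ just []) (*-suc 2 _) (consumeF-alt-exact (t ∷ f) A))
    from : edges (node ts) ≡ 3 + m × consume (node ts) w ≡ just [] → node ts ∈ L
    from (|ts| , ts↓) with consumeF-A̅AAA̅A̅A⁻ ts (2 * m) ts↓
    ... | inj₁ (t , f , refl) =
      ∈-++⁺ˡ (∈-map⁺ leafFirst (∈-forests⁺ (suc-injective (trans (sym (edgesF-insertLeaf t f)) (suc-injective |ts|)))))
    ... | inj₂ (g , refl) =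
      ∈-++⁺ʳ (map leafFirst (forests (suc m)))
        (∈-map⁺ pathFirst (∈-forests⁺ (suc-injective (suc-injective (suc-injective |ts|)))))

mainTheorem12 : ∀ (n : ℕ) → 3 ≤ n →
    InR n (catalan (n ∸ 2) + catalan (n ∸ 3))
    × InR n (catalan 3 * catalan (n ∸ 3))
    × InR n (catalan 2 * catalan (n ∸ 2))
    × InR n (catalan (n ∸ 1))
    × InR n (catalan n)
mainTheorem12 (suc (suc (suc m))) (s≤s (s≤s (s≤s z≤n))) =
  InR-catalan-+ m ,
  InR-catalan-* 3 m ,
  InR-catalan-* 2 (suc m) ,
  subst (InR (3 + m)) (*-identityˡ _) (InR-catalan-* 1 (2 + m)) ,
  subst (InR (3 + m)) (*-identityˡ _) (InR-catalan-* 0 (3 + m))
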